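{- For all integers $n,k$ with $1<k\le n$, $$g_2(n,k)=\sum_{i=k-1}^{n-2}g_2(n-1,i)+1$$ (an empty sum being $0$).
   Context: $C_r=\frac1{r+1}\binom{2r}{r}$ is the Catalan number, and for $1\le k\le n$, $g_2(n,k)=\sum_{i_1+\cdots+i_k=n}C_{i_1-1}\cdots C_{i_k-1}$, the sum over ordered $k$-tuples of positive integers. -}

module Defs where

open import Data.Nat using (ℕ; zero; suc; _+_; _*_; _∸_; _/_)
open import Data.Nat.Combinatorics using (_C_)
open import Data.List using (List; []; _∷_; map; concatMap; upTo)
open import Data.Nat.ListAction using (sum; product)

-- Catalan number C_r = (1/(r+1)) * binom(2r, r)  (exact division)
catalan : ℕ → ℕ
catalan r = ((2 * r) C r) / suc r

-- All ordered k-tuples (i₁,…,i_k) of positive integers with i₁+⋯+i_k = n,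
-- as lists of length k.
compositions : ℕ → ℕ → List (List ℕ)
compositions n zero with n
... | zero  = [] ∷ []
... | suc _ = []
compositions n (suc k) =
  concatMap (λ j → map (suc j ∷_) (compositions (n ∸ suc j) k)) (upTo n)

g₂ : ℕ → ℕ → ℕ
g₂ n k = sum (map (λ t → product (map (λ i → catalan (i ∸ 1)) t)) (compositions n k))

-- Σ_{i=a}^{b} f i  (0 if b < a)
sumFromTo : ℕ → ℕ → (ℕ → ℕ) → ℕ
sumFromTo a b f = sum (map (λ j → f (a + j)) (upTo (suc b ∸ a)))

-- Let C(x) be the Catalan series.  The sequence n ↦ g₂(n,k) has generating
-- function (x C(x))ᵏ, so it is the k-fold convolution of x C(x) with itself,
-- and the Catalan equation C = 1 + x C² turns into the Pascal-type rule
-- g₂(n+1,k+1) = g₂(n,k) + g₂(n+1,k+2).  Iterating it in k until the diagonal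
-- g₂(m,m) = 1 is reached gives the theorem.  The Catalan equation is derived
-- from the closed form binom(2r,r)/(r+1) via the ballot numbers, the
-- coefficients of C(x)ᵏ, which obey both the ballot formula and the
-- convolution rule Cᵏ⁺¹ = C · Cᵏ.
module Submission where

open import Data.List using (List; []; _∷_; _++_; map; concatMap; applyUpTo)
open import Data.List.Properties using (map-++)
open import Data.Nat using (ℕ; zero; suc; _+_; _*_; _∸_; _≤_; _<_; s≤s)
open import Data.Nat.Combinatorics
  using (_C_; nCk≡nC[n∸k]; nCk+nC[k+1]≡[n+1]C[k+1]; nC1≡n)
open import Data.Nat.DivMod using (_/_; m*n/n≡m)
open import Data.Nat.ListAction using (sum; product)
open import Data.Nat.ListAction.Properties using (sum-++)
open import Data.Nat.Properties
open import Algebra.Properties.CommutativeSemigroup +-commutativeSemigroup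
  using (interchange)
open import Function using (_∘_; id; flip)
open import Relation.Binary.PropositionalEquality
open ≡-Reasoning

open import Defs

∑< : ℕ → (ℕ → ℕ) → ℕ
∑< zero    f = 0
∑< (suc n) f = f 0 + ∑< n (f ∘ suc)

syntax ∑< n (λ j → e) = ∑[ j < n ] e

∑<-cong : ∀ n {f g : ℕ → ℕ} → (∀ j → f j ≡ g j) → ∑< n f ≡ ∑< n g
∑<-cong zero    f≗g = refl
∑<-cong (suc n) f≗g = cong₂ _+_ (f≗g 0) (∑<-cong n (f≗g ∘ suc))

∑<-+ : ∀ n (f g : ℕ → ℕ) → ∑[ j < n ] (f j + g j) ≡ ∑< n f + ∑< n g
∑<-+ zero    f g = refl
∑<-+ (suc n) f g = begin
  f 0 + g 0 + ∑[ j < n ] (f (suc j) + g (suc j))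
    ≡⟨ cong (f 0 + g 0 +_) (∑<-+ n (f ∘ suc) (g ∘ suc)) ⟩
  f 0 + g 0 + (∑< n (f ∘ suc) + ∑< n (g ∘ suc))
    ≡⟨ interchange (f 0) (g 0) _ _ ⟩
  f 0 + ∑< n (f ∘ suc) + (g 0 + ∑< n (g ∘ suc)) ∎

sum-map-applyUpTo : ∀ (f g : ℕ → ℕ) n → sum (map f (applyUpTo g n)) ≡ ∑< n (f ∘ g)
sum-map-applyUpTo f g zero    = refl
sum-map-applyUpTo f g (suc n) = cong (f (g 0) +_) (sum-map-applyUpTo f (g ∘ suc) n)

sum-map-concatMap : ∀ {A B : Set} (w : B → ℕ) (f : A → List B) xs →
  sum (map w (concatMap f xs)) ≡ sum (map (λ x → sum (map w (f x))) xs)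
sum-map-concatMap w f []       = refl
sum-map-concatMap w f (x ∷ xs) = begin
  sum (map w (f x ++ concatMap f xs))
    ≡⟨ cong sum (map-++ w (f x) (concatMap f xs)) ⟩
  sum (map w (f x) ++ map w (concatMap f xs))
    ≡⟨ sum-++ (map w (f x)) _ ⟩
  sum (map w (f x)) + sum (map w (concatMap f xs))
    ≡⟨ cong (sum (map w (f x)) +_) (sum-map-concatMap w f xs) ⟩
  sum (map w (f x)) + sum (map (λ x → sum (map w (f x))) xs) ∎

-- (a ⋆ f) n = Σ_{i+j = n-1} a i · f j, the coefficients of x·A(x)·F(x).
infixl 7 _⋆_
_⋆_ : (ℕ → ℕ) → (ℕ → ℕ) → ℕ → ℕ
(a ⋆ f) n = ∑[ j < n ] (a j * f (n ∸ suc j))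

δ : ℕ → ℕ
δ zero    = 1
δ (suc m) = 0

shift : (ℕ → ℕ) → ℕ → ℕ
shift f zero    = 0
shift f (suc m) = f m

⋆-congʳ : ∀ a {f g} → (∀ m → f m ≡ g m) → ∀ n → (a ⋆ f) n ≡ (a ⋆ g) n
⋆-congʳ a f≗g n = ∑<-cong n (λ j → cong (a j *_) (f≗g (n ∸ suc j)))

⋆-distribˡ-+ : ∀ a f g n → (a ⋆ (λ m → f m + g m)) n ≡ (a ⋆ f) n + (a ⋆ g) n
⋆-distribˡ-+ a f g n =
  trans (∑<-cong n (λ j → *-distribˡ-+ (a j) (f (n ∸ suc j)) (g (n ∸ suc j))))
        (∑<-+ n _ _)

⋆-shift : ∀ a f n → (a ⋆ shift f) (suc n) ≡ (a ⋆ f) n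
⋆-shift a f zero    = cong (_+ 0) (*-zeroʳ (a 0))
⋆-shift a f (suc n) = cong (a 0 * f n +_) (⋆-shift (a ∘ suc) f n)

⋆-δ : ∀ a n → (a ⋆ δ) (suc n) ≡ a n
⋆-δ a zero    = trans (+-identityʳ (a 0 * 1)) (*-identityʳ (a 0))
⋆-δ a (suc n) =
  trans (cong (_+ (a ∘ suc ⋆ δ) (suc n)) (*-zeroʳ (a 0))) (⋆-δ (a ∘ suc) n)

⋆-vanish : ∀ a f n → (∀ i → i < n → f i ≡ 0) → (a ⋆ f) n ≡ 0
⋆-vanish a f zero    f<n≡0 = refl
⋆-vanish a f (suc n) f<n≡0 = cong₂ _+_
  (trans (cong (a 0 *_) (f<n≡0 n ≤-refl)) (*-zeroʳ (a 0)))
  (⋆-vanish (a ∘ suc) f n (λ i i<n → f<n≡0 i (m≤n⇒m≤1+n i<n)))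

⋆-shift-+ : ∀ a {u v w} → (∀ m → u m ≡ shift v m + w m) →
  ∀ n → (a ⋆ u) (suc n) ≡ (a ⋆ v) n + (a ⋆ w) (suc n)
⋆-shift-+ a {u} {v} {w} u≗ n = begin
  (a ⋆ u) (suc n)                            ≡⟨ ⋆-congʳ a u≗ (suc n) ⟩
  (a ⋆ (λ m → shift v m + w m)) (suc n)      ≡⟨ ⋆-distribˡ-+ a (shift v) w (suc n) ⟩
  (a ⋆ shift v) (suc n) + (a ⋆ w) (suc n)    ≡⟨ cong (_+ _) (⋆-shift a v n) ⟩
  (a ⋆ v) n + (a ⋆ w) (suc n)                ∎

-- M C⁻ n = binom(M, n-1); unlike M C (n ∸ 1) it vanishes at n = 0.
_C⁻_ : ℕ → ℕ → ℕ
M C⁻ zero    = 0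
M C⁻ (suc n) = M C n

pascal⁻ : ∀ M n → suc M C n ≡ M C⁻ n + M C n
pascal⁻ M zero    = refl
pascal⁻ M (suc n) = sym (nCk+nC[k+1]≡[n+1]C[k+1] M n)

C-sym : ∀ m n → (m + n) C m ≡ (m + n) C n
C-sym m n = trans (nCk≡nC[n∸k] (m≤m+n m n)) (cong ((m + n) C_) (m+n∸m≡n m n))

absorption : ∀ n k → suc k * (suc n C suc k) ≡ suc n * (n C k)
absorption n       zero    =
  trans (*-identityˡ (suc n C 1)) (trans (nC1≡n (suc n)) (sym (*-identityʳ (suc n))))
absorption zero    (suc k) = *-zeroʳ (suc (suc k))
absorption (suc n) (suc k) = begin
  suc (suc k) * (suc (suc n) C suc (suc k))
    ≡⟨ cong (suc (suc k) *_) (sym (nCk+nC[k+1]≡[n+1]C[k+1] (suc n) (suc k))) ⟩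
  suc (suc k) * (suc n C suc k + suc n C suc (suc k))
    ≡⟨ *-distribˡ-+ (suc (suc k)) (suc n C suc k) _ ⟩
  suc n C suc k + suc k * (suc n C suc k) + suc (suc k) * (suc n C suc (suc k))
    ≡⟨ cong₂ (λ x y → suc n C suc k + x + y) (absorption n k) (absorption n (suc k)) ⟩
  suc n C suc k + suc n * (n C k) + suc n * (n C suc k)
    ≡⟨ +-assoc (suc n C suc k) _ _ ⟩
  suc n C suc k + (suc n * (n C k) + suc n * (n C suc k))
    ≡⟨ cong (suc n C suc k +_) (sym (*-distribˡ-+ (suc n) (n C k) (n C suc k))) ⟩
  suc n C suc k + suc n * (n C k + n C suc k)
    ≡⟨ cong (λ x → suc n C suc k + suc n * x) (nCk+nC[k+1]≡[n+1]C[k+1] n k) ⟩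
  suc n C suc k + suc n * (suc n C suc k) ∎

-- ballot n k is the coefficient of xⁿ in C(x)ᵏ, i.e. k/(2n+k) · binom(2n+k, n) for k > 0.
ballot : ℕ → ℕ → ℕ
ballot zero    k       = 1
ballot (suc n) zero    = 0
ballot (suc n) (suc k) = ballot n (suc (suc k)) + ballot (suc n) k

ballot-closed : ∀ n k → ballot n (suc k) + (k + n + n) C⁻ n ≡ (k + n + n) C n
ballot-closed zero    k       = refl
ballot-closed (suc n) zero    = begin
  ballot n 2 + 0 + suc M C n      ≡⟨ cong₂ _+_ (+-identityʳ (ballot n 2)) (pascal⁻ M n) ⟩
  ballot n 2 + (M C⁻ n + M C n)   ≡⟨ +-assoc (ballot n 2) _ _ ⟨
  ballot n 2 + M C⁻ n + M C n     ≡⟨ cong (_+ M C n) ballot-closed-n ⟩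
  M C n + M C n                   ≡⟨ cong (M C n +_) (C-sym n (suc n)) ⟩
  M C n + M C suc n               ≡⟨ nCk+nC[k+1]≡[n+1]C[k+1] M n ⟩
  suc M C suc n                   ∎
  where
    M = n + suc n
    ballot-closed-n : ballot n 2 + M C⁻ n ≡ M C n
    ballot-closed-n =
      subst (λ T → ballot n 2 + T C⁻ n ≡ T C n) (sym (+-suc n n)) (ballot-closed n 1)
ballot-closed (suc n) (suc k) = begin
  ballot n (3 + k) + ballot (suc n) (suc k) + suc M C n
    ≡⟨ cong (ballot n (3 + k) + ballot (suc n) (suc k) +_) (pascal⁻ M n) ⟩
  ballot n (3 + k) + ballot (suc n) (suc k) + (M C⁻ n + M C n)
    ≡⟨ interchange (ballot n (3 + k)) _ _ _ ⟩
  (ballot n (3 + k) + M C⁻ n) + (ballot (suc n) (suc k) + M C n)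
    ≡⟨ cong₂ _+_ ballot-closed-n (ballot-closed (suc n) k) ⟩
  M C n + M C suc n
    ≡⟨ nCk+nC[k+1]≡[n+1]C[k+1] M n ⟩
  suc M C suc n ∎
  where
    M = k + suc n + suc n
    M≡2+k+n+n : M ≡ 2 + k + n + n
    M≡2+k+n+n = trans (+-suc (k + suc n) n) (cong (λ T → suc (T + n)) (+-suc k n))
    ballot-closed-n : ballot n (3 + k) + M C⁻ n ≡ M C n
    ballot-closed-n = subst (λ T → ballot n (3 + k) + T C⁻ n ≡ T C n)
      (sym M≡2+k+n+n) (ballot-closed n (2 + k))

catalan-absorption : ∀ r → suc r * ((r + r) C⁻ r) ≡ r * ((r + r) C r)
catalan-absorption zero    = refl
catalan-absorption (suc r) = begin
  suc (suc r) * (N C r)             ≡⟨ cong (suc (suc r) *_) N-sym ⟩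
  suc (suc r) * (N C suc (suc r))   ≡⟨ absorption N′ (suc r) ⟩
  N * (N′ C suc r)                  ≡⟨ cong (N *_) (C-sym r (suc r)) ⟨
  N * (N′ C r)                      ≡⟨ absorption N′ r ⟨
  suc r * (N C suc r)               ∎
  where
    N′ = r + suc r
    N  = suc N′
    N-sym : N C r ≡ N C suc (suc r)
    N-sym = subst (λ T → T C r ≡ T C suc (suc r)) (+-suc r (suc r)) (C-sym r (suc (suc r)))

suc-*-ballot : ∀ r → suc r * ballot r 1 ≡ (r + r) C r
suc-*-ballot r = +-cancelʳ-≡ (r * B) _ _ (begin
  suc r * ballot r 1 + r * B          ≡⟨ cong (suc r * ballot r 1 +_) (catalan-absorption r) ⟨
  suc r * ballot r 1 + suc r * A      ≡⟨ *-distribˡ-+ (suc r) (ballot r 1) A ⟨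
  suc r * (ballot r 1 + A)            ≡⟨ cong (suc r *_) (ballot-closed r 0) ⟩
  suc r * B                           ∎)
  where
    A = (r + r) C⁻ r
    B = (r + r) C r

catalan≡ballot : ∀ r → catalan r ≡ ballot r 1
catalan≡ballot r = begin
  ((2 * r) C r) / suc r        ≡⟨ cong (λ T → ((r + T) C r) / suc r) (+-identityʳ r) ⟩
  ((r + r) C r) / suc r        ≡⟨ cong (_/ suc r) (suc-*-ballot r) ⟨
  (suc r * ballot r 1) / suc r ≡⟨ cong (_/ suc r) (*-comm (suc r) (ballot r 1)) ⟩
  (ballot r 1 * suc r) / suc r ≡⟨ m*n/n≡m (ballot r 1) (suc r) ⟩
  ballot r 1                   ∎

ballot-⋆ : ∀ n k → (catalan ⋆ flip ballot k) (suc n) ≡ ballot n (suc k)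
ballot-⋆ zero    k       = refl
ballot-⋆ (suc n) zero    = begin
  (catalan ⋆ flip ballot 0) (suc (suc n))  ≡⟨ ⋆-congʳ catalan ballot-zero (suc (suc n)) ⟩
  (catalan ⋆ δ) (suc (suc n))              ≡⟨ ⋆-δ catalan (suc n) ⟩
  catalan (suc n)                          ≡⟨ catalan≡ballot (suc n) ⟩
  ballot (suc n) 1                         ∎
  where
    ballot-zero : ∀ m → ballot m 0 ≡ δ m
    ballot-zero zero    = refl
    ballot-zero (suc m) = refl
ballot-⋆ (suc n) (suc k) = begin
  (catalan ⋆ flip ballot (suc k)) (suc (suc n))
    ≡⟨ ⋆-shift-+ catalan ballot-split (suc n) ⟩
  (catalan ⋆ flip ballot (2 + k)) (suc n) + (catalan ⋆ flip ballot k) (suc (suc n))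
    ≡⟨ cong₂ _+_ (ballot-⋆ n (2 + k)) (ballot-⋆ (suc n) k) ⟩
  ballot (suc n) (2 + k) ∎
  where
    ballot-split : ∀ m → ballot m (suc k) ≡ shift (flip ballot (2 + k)) m + ballot m k
    ballot-split zero    = refl
    ballot-split (suc m) = refl

catalan-recurrence : ∀ n → catalan n ≡ δ n + (catalan ⋆ catalan) n
catalan-recurrence zero    = refl
catalan-recurrence (suc n) = begin
  catalan (suc n)                         ≡⟨ catalan≡ballot (suc n) ⟩
  ballot n 2 + 0                          ≡⟨ +-identityʳ (ballot n 2) ⟩
  ballot n 2                              ≡⟨ ballot-⋆ n 1 ⟨
  (catalan ⋆ flip ballot 1) (suc n)       ≡⟨ ⋆-congʳ catalan catalan≡ballot (suc n) ⟨
  (catalan ⋆ catalan) (suc n)             ∎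

weight : List ℕ → ℕ
weight t = product (map (λ i → catalan (i ∸ 1)) t)

sum-weight-cons : ∀ j ts →
  sum (map weight (map (suc j ∷_) ts)) ≡ catalan j * sum (map weight ts)
sum-weight-cons j []       = sym (*-zeroʳ (catalan j))
sum-weight-cons j (t ∷ ts) = begin
  catalan j * weight t + sum (map weight (map (suc j ∷_) ts))
    ≡⟨ cong (catalan j * weight t +_) (sum-weight-cons j ts) ⟩
  catalan j * weight t + catalan j * sum (map weight ts)
    ≡⟨ *-distribˡ-+ (catalan j) (weight t) _ ⟨
  catalan j * sum (map weight (t ∷ ts)) ∎

g₂-suc : ∀ n k → g₂ n (suc k) ≡ (catalan ⋆ flip g₂ k) n
g₂-suc n k = begin
  sum (map weight (concatMap parts (applyUpTo id n)))
    ≡⟨ sum-map-concatMap weight parts (applyUpTo id n) ⟩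
  sum (map (λ j → sum (map weight (parts j))) (applyUpTo id n))
    ≡⟨ sum-map-applyUpTo _ id n ⟩
  ∑[ j < n ] sum (map weight (parts j))
    ≡⟨ ∑<-cong n (λ j → sum-weight-cons j (compositions (n ∸ suc j) k)) ⟩
  (catalan ⋆ flip g₂ k) n ∎
  where
    parts : ℕ → List (List ℕ)
    parts j = map (suc j ∷_) (compositions (n ∸ suc j) k)

g₂-zero : ∀ n → g₂ n 0 ≡ δ n
g₂-zero zero    = refl
g₂-zero (suc n) = refl

g₂-one : ∀ n → g₂ n 1 ≡ shift catalan n
g₂-one zero    = refl
g₂-one (suc n) = begin
  g₂ (suc n) 1                ≡⟨ g₂-suc (suc n) 0 ⟩
  (catalan ⋆ flip g₂ 0) (suc n) ≡⟨ ⋆-congʳ catalan g₂-zero (suc n) ⟩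
  (catalan ⋆ δ) (suc n)       ≡⟨ ⋆-δ catalan n ⟩
  catalan n                   ∎

g₂-< : ∀ n k → n < k → g₂ n k ≡ 0
g₂-< n (suc k) n<k = trans (g₂-suc n k)
  (⋆-vanish catalan (flip g₂ k) n (λ i i<n → g₂-< i k (≤-trans i<n (≤-pred n<k))))

g₂-diag : ∀ k → g₂ k k ≡ 1
g₂-diag zero    = refl
g₂-diag (suc k) = begin
  g₂ (suc k) (suc k)                          ≡⟨ g₂-suc (suc k) k ⟩
  1 * g₂ k k + (catalan ∘ suc ⋆ flip g₂ k) k  ≡⟨ cong₂ _+_ (*-identityˡ (g₂ k k)) vanish ⟩
  g₂ k k + 0                                  ≡⟨ +-identityʳ (g₂ k k) ⟩
  g₂ k k                                      ≡⟨ g₂-diag k ⟩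
  1                                           ∎
  where
    vanish : (catalan ∘ suc ⋆ flip g₂ k) k ≡ 0
    vanish = ⋆-vanish (catalan ∘ suc) (flip g₂ k) k (λ i i<k → g₂-< i k i<k)

g₂-pascal : ∀ n k → g₂ (suc n) (suc k) ≡ g₂ n k + g₂ (suc n) (2 + k)
g₂-pascal n zero = begin
  g₂ (suc n) 1
    ≡⟨ g₂-one (suc n) ⟩
  catalan n
    ≡⟨ catalan-recurrence n ⟩
  δ n + (catalan ⋆ catalan) n
    ≡⟨ cong₂ _+_ (g₂-zero n) (⋆-shift catalan catalan n) ⟨
  g₂ n 0 + (catalan ⋆ shift catalan) (suc n)
    ≡⟨ cong (g₂ n 0 +_) (⋆-congʳ catalan g₂-one (suc n)) ⟨
  g₂ n 0 + (catalan ⋆ flip g₂ 1) (suc n)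
    ≡⟨ cong (g₂ n 0 +_) (g₂-suc (suc n) 1) ⟨
  g₂ n 0 + g₂ (suc n) 2 ∎
g₂-pascal n (suc k) = begin
  g₂ (suc n) (2 + k)
    ≡⟨ g₂-suc (suc n) (suc k) ⟩
  (catalan ⋆ flip g₂ (suc k)) (suc n)
    ≡⟨ ⋆-shift-+ catalan g₂-split n ⟩
  (catalan ⋆ flip g₂ k) n + (catalan ⋆ flip g₂ (2 + k)) (suc n)
    ≡⟨ cong₂ _+_ (g₂-suc n k) (g₂-suc (suc n) (2 + k)) ⟨
  g₂ n (suc k) + g₂ (suc n) (3 + k) ∎
  where
    g₂-split : ∀ m → g₂ m (suc k) ≡ shift (flip g₂ k) m + g₂ m (2 + k)
    g₂-split zero    = refl
    g₂-split (suc m) = g₂-pascal m k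

g₂-telescope : ∀ d k n → d + k ≡ n →
  g₂ (suc n) (suc k) ≡ ∑[ j < d ] g₂ n (k + j) + 1
g₂-telescope zero    k .k refl = g₂-diag (suc k)
g₂-telescope (suc d) k n d+k≡n = begin
  g₂ (suc n) (suc k)
    ≡⟨ g₂-pascal n k ⟩
  g₂ n k + g₂ (suc n) (2 + k)
    ≡⟨ cong (g₂ n k +_) (g₂-telescope d (suc k) n (trans (+-suc d k) d+k≡n)) ⟩
  g₂ n k + (∑[ j < d ] g₂ n (suc k + j) + 1)
    ≡⟨ +-assoc (g₂ n k) _ 1 ⟨
  g₂ n k + ∑[ j < d ] g₂ n (suc k + j) + 1
    ≡⟨ cong (_+ 1) (cong₂ _+_ (cong (g₂ n) (+-identityʳ k))
                              (∑<-cong d (cong (g₂ n) ∘ +-suc k))) ⟨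
  ∑[ j < suc d ] g₂ n (k + j) + 1 ∎

mainTheorem7 : (n k : ℕ) → 1 < k → k ≤ n →
    g₂ n k ≡ sumFromTo (k ∸ 1) (n ∸ 2) (λ i → g₂ (n ∸ 1) i) + 1
mainTheorem7 (suc (suc n)) (suc (suc k)) (s≤s (s≤s _)) (s≤s (s≤s k≤n)) = begin
  g₂ (2 + n) (2 + k)
    ≡⟨ g₂-telescope (n ∸ k) (suc k) (suc n) length ⟩
  ∑[ j < n ∸ k ] g₂ (suc n) (suc k + j) + 1
    ≡⟨ cong (_+ 1) (sum-map-applyUpTo (λ j → g₂ (suc n) (suc k + j)) id (n ∸ k)) ⟨
  sumFromTo (suc k) n (g₂ (suc n)) + 1 ∎
  where
    length : n ∸ k + suc k ≡ suc n
    length = trans (+-suc (n ∸ k) k) (cong suc (m∸n+n≡m k≤n))
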